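{- For all $\pi,\sigma\in S_n$, we have $\overline{\pi\circ\sigma}=\overline{\pi}\circ\pi\circ\overline{\sigma}\circ\pi^{ -1}$, i.e. $\overline{\pi\circ\sigma}=\overline{\pi}\circ\overline{\sigma}^{\pi}$.
   Context: Permutations are composed from right to left. A permutation $\pi$ of $\{1,\ldots,n\}$ is written $\langle \pi_1\ \cdots\ \pi_n\rangle$ with $\pi_i=\pi(i)$ and is identified with the permutation of $\{0,1,\ldots,n\}$ fixing $0$. For $\pi\in S_n$, $\overline{\pi}=(0,1,2,\ldots,n)\circ(0,\pi_n,\pi_{n-1},\ldots,\pi_1)$, a permutation of $\{0,\ldots,n\}$ in cycle notation. For permutations $\alpha,\beta$, the conjugate is $\alpha^{\beta}=\beta\circ\alpha\circ\beta^{ -1}$. -}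

module Defs where

open import Data.Nat using (ℕ; suc)
open import Data.Fin using (Fin; zero; suc; _≟_)
open import Data.List using (List; []; _∷_; allFin; map; reverse)
open import Data.Bool using (if_then_else_)
open import Relation.Nullary using (does)
open import Data.Fin.Permutation using (Permutation′; _⟨$⟩ʳ_; _∘ₚ_; flip; lift₀)

-- Composition right-to-left, as in the paper: (π ∘ᵖ σ)(i) = π(σ(i)).
-- (stdlib's _∘ₚ_ is diagrammatic: (σ ∘ₚ π) applies σ first.)
_∘ᵖ_ : ∀ {n} → Permutation′ n → Permutation′ n → Permutation′ n
π ∘ᵖ σ = σ ∘ₚ π

cycle : ∀ {m} → List (Fin m) → Fin m → Fin m
cycle [] x = x
cycle {m} (a ∷ as) x = go (a ∷ as) x
  where
  go : List (Fin m) → Fin m → Fin m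
  go [] y = y
  go (b ∷ []) y = if does (y ≟ b) then a else y
  go (b ∷ c ∷ rest) y = if does (y ≟ b) then c else go (c ∷ rest) y

-- ⟨π₁ ⋯ πₙ⟩ as a permutation of {0,…,n} fixing 0 (Fin (suc n), 0 = zero).
embed : ∀ {n} → Permutation′ n → Permutation′ (suc n)
embed = lift₀

values : ∀ {n} → Permutation′ n → List (Fin (suc n))
values {n} π = map (λ i → suc (π ⟨$⟩ʳ i)) (allFin n)

bar : ∀ {n} → Permutation′ n → Fin (suc n) → Fin (suc n)
bar {n} π x = cycle (allFin (suc n)) (cycle (zero ∷ reverse (values π)) x)

-- Let Π be π acting on {0,…,n} with 0 fixed, and let ρ be the cycle (0, n, n−1, …, 1).
-- The list 0, πₙ, …, π₁ is the image under Π of 0, n, …, 1, so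
-- (0, πₙ, …, π₁) = Π ∘ ρ ∘ Π⁻¹, while (0, 1, …, n) = ρ⁻¹. Hence π̄ = ρ⁻¹ ∘ Π ∘ ρ ∘ Π⁻¹, and
-- π̄ ∘ Π ∘ σ̄ ∘ Π⁻¹ = ρ⁻¹ Π ρ Π⁻¹ Π ρ⁻¹ Σ ρ Σ⁻¹ Π⁻¹ = ρ⁻¹ (Π Σ) ρ (Π Σ)⁻¹ = the bar of π ∘ σ.
module Submission where

open import Defs
open import Data.Nat using (ℕ; zero; suc)
open import Data.Fin using (Fin; zero; suc; _≟_; fromℕ; inject₁; opposite)
open import Data.Fin.Properties using (opposite-involutive; suc-injective)
open import Data.Fin.Permutation using (Permutation′; _⟨$⟩ʳ_; _⟨$⟩ˡ_; lift₀; lift₀-comp; inverseˡ; inverseʳ)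
open import Data.List using (List; []; _∷_; tabulate; reverse; _∷ʳ_; allFin)
open import Data.List.Properties using (unfold-reverse; map-tabulate; tabulate-cong)
open import Function using (_∘_; id)
open import Function.Definitions using (Injective)
open import Function.Bundles using (Injection)
open import Function.Properties.Inverse using (↔⇒↣)
open import Relation.Nullary using (yes; no)
open import Relation.Binary.PropositionalEquality
  using (_≡_; _≢_; refl; sym; trans; cong; cong₂; module ≡-Reasoning)
open import Data.Empty using (⊥-elim)

private
  variable
    m k : ℕ

  tail≢head : {g : Fin (suc k) → Fin m} → Injective _≡_ _≡_ g → ∀ i → g (suc i) ≢ g zero
  tail≢head g-inj i eq with g-inj eq
  ... | ()

cycle-skip : (a b : Fin m) (rest : List (Fin m)) {y : Fin m} → y ≢ a → y ≢ b →
             cycle (a ∷ b ∷ rest) y ≡ cycle (a ∷ rest) y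
cycle-skip a b []      {y} y≢a y≢b with y ≟ a | y ≟ b
... | yes y≡a | _       = ⊥-elim (y≢a y≡a)
... | no _    | yes y≡b = ⊥-elim (y≢b y≡b)
... | no _    | no _    = refl
cycle-skip a b (_ ∷ _) {y} y≢a y≢b with y ≟ a | y ≟ b
... | yes y≡a | _       = ⊥-elim (y≢a y≡a)
... | no _    | yes y≡b = ⊥-elim (y≢b y≡b)
... | no _    | no _    = refl

module _ (a : Fin m) where

  cycle-∷-tabulate-head : (f : Fin (suc k) → Fin m) → cycle (a ∷ tabulate f) a ≡ f zero
  cycle-∷-tabulate-head {k = zero}  f with a ≟ a
  ... | yes _   = refl
  ... | no a≢a = ⊥-elim (a≢a refl)
  cycle-∷-tabulate-head {k = suc _} f with a ≟ a
  ... | yes _   = refl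
  ... | no a≢a = ⊥-elim (a≢a refl)

  private
    skip-head : (f : Fin (suc (suc k)) → Fin m) → (∀ i → f i ≢ a) → Injective _≡_ _≡_ f →
                (i : Fin (suc k)) →
                cycle (a ∷ tabulate f) (f (suc i)) ≡ cycle (a ∷ tabulate (f ∘ suc)) (f (suc i))
    skip-head f f≢a f-inj i = cycle-skip a (f zero) (tabulate (f ∘ suc)) (f≢a _) (tail≢head f-inj i)

  cycle-∷-tabulate-inject₁ : (f : Fin (suc k) → Fin m) → (∀ i → f i ≢ a) → Injective _≡_ _≡_ f →
                             (j : Fin k) → cycle (a ∷ tabulate f) (f (inject₁ j)) ≡ f (suc j)
  cycle-∷-tabulate-inject₁ f f≢a f-inj zero with f zero ≟ a | f zero ≟ f zero
  ... | yes eq | _      = ⊥-elim (f≢a zero eq)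
  ... | no _   | yes _  = refl
  ... | no _   | no neq = ⊥-elim (neq refl)
  cycle-∷-tabulate-inject₁ f f≢a f-inj (suc j) = trans (skip-head f f≢a f-inj _)
    (cycle-∷-tabulate-inject₁ (f ∘ suc) (f≢a ∘ suc) (suc-injective ∘ f-inj) j)

  cycle-∷-tabulate-fromℕ : (f : Fin (suc k) → Fin m) → (∀ i → f i ≢ a) → Injective _≡_ _≡_ f →
                           cycle (a ∷ tabulate f) (f (fromℕ k)) ≡ a
  cycle-∷-tabulate-fromℕ {k = zero} f f≢a f-inj with f zero ≟ a | f zero ≟ f zero
  ... | yes eq | _      = ⊥-elim (f≢a zero eq)
  ... | no _   | yes _  = refl
  ... | no _   | no neq = ⊥-elim (neq refl)
  cycle-∷-tabulate-fromℕ {k = suc _} f f≢a f-inj = trans (skip-head f f≢a f-inj _)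
    (cycle-∷-tabulate-fromℕ (f ∘ suc) (f≢a ∘ suc) (suc-injective ∘ f-inj))

-- As a permutation, cyclicPred is the cycle (0, k, k−1, …, 1).
cyclicPred : Fin (suc k) → Fin (suc k)
cyclicPred {k} zero = fromℕ k
cyclicPred (suc i)  = inject₁ i

cycle-tabulate : (g : Fin (suc k) → Fin m) → Injective _≡_ _≡_ g →
                 ∀ i → cycle (tabulate g) (g (cyclicPred i)) ≡ g i
cycle-tabulate {k = zero} g g-inj zero with g zero ≟ g zero
... | yes _  = refl
... | no neq = ⊥-elim (neq refl)
cycle-tabulate {k = suc _} g g-inj zero =
  cycle-∷-tabulate-fromℕ (g zero) (g ∘ suc) (tail≢head g-inj) (suc-injective ∘ g-inj)
cycle-tabulate {k = suc _} g g-inj (suc zero) = cycle-∷-tabulate-head (g zero) (g ∘ suc)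
cycle-tabulate {k = suc _} g g-inj (suc (suc j)) =
  cycle-∷-tabulate-inject₁ (g zero) (g ∘ suc) (tail≢head g-inj) (suc-injective ∘ g-inj) j

tabulate-∷ʳ : ∀ {a} {A : Set a} (h : Fin (suc k) → A) →
              tabulate h ≡ tabulate (h ∘ inject₁) ∷ʳ h (fromℕ k)
tabulate-∷ʳ {k = zero}  h = refl
tabulate-∷ʳ {k = suc _} h = cong (h zero ∷_) (tabulate-∷ʳ (h ∘ suc))

opposite-inject₁ : (i : Fin k) → opposite (inject₁ i) ≡ suc (opposite i)
opposite-inject₁ {suc _} zero    = refl
opposite-inject₁ {suc _} (suc i) = cong inject₁ (opposite-inject₁ i)

opposite-fromℕ : ∀ k → opposite (fromℕ k) ≡ zero
opposite-fromℕ zero    = refl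
opposite-fromℕ (suc k) = cong inject₁ (opposite-fromℕ k)

reverse-tabulate : ∀ {a} {A : Set a} (g : Fin k → A) →
                   reverse (tabulate g) ≡ tabulate (g ∘ opposite)
reverse-tabulate {zero}  g = refl
reverse-tabulate {suc k} g = begin
  reverse (tabulate g)
    ≡⟨ unfold-reverse (g zero) (tabulate (g ∘ suc)) ⟩
  reverse (tabulate (g ∘ suc)) ∷ʳ g zero
    ≡⟨ cong (_∷ʳ g zero) (reverse-tabulate (g ∘ suc)) ⟩
  tabulate (g ∘ suc ∘ opposite) ∷ʳ g zero
    ≡⟨ cong₂ _∷ʳ_ (tabulate-cong (cong g ∘ sym ∘ opposite-inject₁)) (cong g (sym (opposite-fromℕ k))) ⟩
  tabulate (g ∘ opposite ∘ inject₁) ∷ʳ g (opposite (fromℕ k))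
    ≡⟨ tabulate-∷ʳ (g ∘ opposite) ⟨
  tabulate (g ∘ opposite)
    ∎
  where open ≡-Reasoning

reflect : Fin (suc k) → Fin (suc k)
reflect zero    = zero
reflect (suc i) = suc (opposite i)

reflect-involutive : (i : Fin (suc k)) → reflect (reflect i) ≡ i
reflect-involutive zero    = refl
reflect-involutive (suc i) = cong suc (opposite-involutive i)

reflect-injective : Injective _≡_ _≡_ (reflect {k})
reflect-injective {x = i} {j} eq =
  trans (sym (reflect-involutive i)) (trans (cong reflect eq) (reflect-involutive j))

cyclicPred-reflect : (i : Fin (suc k)) → cyclicPred (reflect i) ≡ opposite i
cyclicPred-reflect zero    = refl
cyclicPred-reflect (suc i) = refl

opposite-reflect : (i : Fin (suc k)) → opposite (reflect i) ≡ cyclicPred i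
opposite-reflect zero    = refl
opposite-reflect (suc i) = cong inject₁ (opposite-involutive i)

cyclicPred-reflect-opposite : (i : Fin (suc k)) → cyclicPred (reflect (opposite i)) ≡ i
cyclicPred-reflect-opposite i = trans (cyclicPred-reflect (opposite i)) (opposite-involutive i)

cyclicPred-cycle-allFin : (z : Fin (suc k)) → cyclicPred (cycle (allFin (suc k)) z) ≡ z
cyclicPred-cycle-allFin {k} z = begin
  cyclicPred (cycle (allFin (suc k)) z)              ≡⟨ cong (cyclicPred ∘ cycle (allFin (suc k))) w-pred ⟨
  cyclicPred (cycle (allFin (suc k)) (cyclicPred w)) ≡⟨ cong cyclicPred (cycle-tabulate id id w) ⟩
  cyclicPred w                                       ≡⟨ w-pred ⟩
  z                                                  ∎
  where
  open ≡-Reasoning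
  w = reflect (opposite z)
  w-pred : cyclicPred w ≡ z
  w-pred = cyclicPred-reflect-opposite z

module _ {n : ℕ} (π : Permutation′ n) where

  private
    Π = lift₀ π

    Π-injective : Injective _≡_ _≡_ (Π ⟨$⟩ʳ_)
    Π-injective = Injection.injective (↔⇒↣ Π)

  reverse-values : zero ∷ reverse (values π) ≡ tabulate ((Π ⟨$⟩ʳ_) ∘ reflect)
  reverse-values = cong (zero ∷_) (trans
    (cong reverse (map-tabulate id (λ i → suc (π ⟨$⟩ʳ i))))
    (reverse-tabulate (λ i → suc (π ⟨$⟩ʳ i))))

  cycle-reverse-values : (x : Fin (suc n)) →
    cycle (zero ∷ reverse (values π)) x ≡ Π ⟨$⟩ʳ cyclicPred (Π ⟨$⟩ˡ x)
  cycle-reverse-values x = begin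
    cycle (zero ∷ reverse (values π)) x
      ≡⟨ cong (λ L → cycle L x) reverse-values ⟩
    cycle (tabulate g) x
      ≡⟨ cong (cycle (tabulate g)) x≡g[pred-i] ⟨
    cycle (tabulate g) (g (cyclicPred i))
      ≡⟨ cycle-tabulate g (reflect-injective ∘ Π-injective) i ⟩
    Π ⟨$⟩ʳ reflect (reflect (opposite (reflect u)))
      ≡⟨ cong (Π ⟨$⟩ʳ_) (reflect-involutive (opposite (reflect u))) ⟩
    Π ⟨$⟩ʳ opposite (reflect u)
      ≡⟨ cong (Π ⟨$⟩ʳ_) (opposite-reflect u) ⟩
    Π ⟨$⟩ʳ cyclicPred u
      ∎
    where
    open ≡-Reasoning
    g = (Π ⟨$⟩ʳ_) ∘ reflect
    u = Π ⟨$⟩ˡ x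
    i = reflect (opposite (reflect u))
    x≡g[pred-i] : g (cyclicPred i) ≡ x
    x≡g[pred-i] = begin
      Π ⟨$⟩ʳ reflect (cyclicPred i) ≡⟨ cong ((Π ⟨$⟩ʳ_) ∘ reflect) (cyclicPred-reflect-opposite (reflect u)) ⟩
      Π ⟨$⟩ʳ reflect (reflect u)    ≡⟨ cong (Π ⟨$⟩ʳ_) (reflect-involutive u) ⟩
      Π ⟨$⟩ʳ u                      ≡⟨ inverseʳ Π ⟩
      x                             ∎

  bar-conjugate : (x : Fin (suc n)) →
    bar π x ≡ cycle (allFin (suc n)) (Π ⟨$⟩ʳ cyclicPred (Π ⟨$⟩ˡ x))
  bar-conjugate x = cong (cycle (allFin (suc n))) (cycle-reverse-values x)

lift₀-∘ᵖ-inverse : ∀ {n} (π σ : Permutation′ n) (x : Fin (suc n)) →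
                   lift₀ (π ∘ᵖ σ) ⟨$⟩ˡ x ≡ lift₀ σ ⟨$⟩ˡ (lift₀ π ⟨$⟩ˡ x)
lift₀-∘ᵖ-inverse π σ zero    = refl
lift₀-∘ᵖ-inverse π σ (suc x) = refl

lemma1 : (n : ℕ) (π σ : Permutation′ n) (x : Fin (suc n)) →
    bar (π ∘ᵖ σ) x ≡ bar π (embed π ⟨$⟩ʳ (bar σ (embed π ⟨$⟩ˡ x)))
lemma1 n π σ x = begin
  bar (π ∘ᵖ σ) x
    ≡⟨ bar-conjugate (π ∘ᵖ σ) x ⟩
  S (lift₀ (π ∘ᵖ σ) ⟨$⟩ʳ cyclicPred (lift₀ (π ∘ᵖ σ) ⟨$⟩ˡ x))
    ≡⟨ cong (λ y → S (lift₀ (π ∘ᵖ σ) ⟨$⟩ʳ cyclicPred y)) (lift₀-∘ᵖ-inverse π σ x) ⟩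
  S (lift₀ (π ∘ᵖ σ) ⟨$⟩ʳ w)
    ≡⟨ cong S (lift₀-comp σ π w) ⟨
  S (Π ⟨$⟩ʳ (Σ ⟨$⟩ʳ w))
    ≡⟨ cong (S ∘ (Π ⟨$⟩ʳ_)) (cyclicPred-cycle-allFin (Σ ⟨$⟩ʳ w)) ⟨
  S (Π ⟨$⟩ʳ cyclicPred (S (Σ ⟨$⟩ʳ w)))
    ≡⟨ cong (λ y → S (Π ⟨$⟩ʳ cyclicPred y)) (inverseˡ Π {S (Σ ⟨$⟩ʳ w)}) ⟨
  S (Π ⟨$⟩ʳ cyclicPred (Π ⟨$⟩ˡ (Π ⟨$⟩ʳ S (Σ ⟨$⟩ʳ w))))
    ≡⟨ bar-conjugate π (Π ⟨$⟩ʳ S (Σ ⟨$⟩ʳ w)) ⟨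
  bar π (Π ⟨$⟩ʳ S (Σ ⟨$⟩ʳ w))
    ≡⟨ cong (bar π ∘ (Π ⟨$⟩ʳ_)) (bar-conjugate σ (Π ⟨$⟩ˡ x)) ⟨
  bar π (Π ⟨$⟩ʳ bar σ (Π ⟨$⟩ˡ x))
    ∎
  where
  open ≡-Reasoning
  S = cycle (allFin (suc n))
  Π = lift₀ π
  Σ = lift₀ σ
  w = cyclicPred (Σ ⟨$⟩ˡ (Π ⟨$⟩ˡ x))
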